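{- Let $G$ be a graph with $G\not\cong K_1$ and $G\not\cong K_2$ such that $\tau(G)\ge 1/2$. Then there exists a spanning subgraph $H$ of $G$ with $\tau(H)=1/2$.
   Context: All graphs are finite, simple and undirected; $\omega(H)$ denotes the number of connected components of $H$. For a real $t$, a graph $G$ is $t$-tough if $|S|\ge t\,\omega(G-S)$ for every $S\subseteq V(G)$ with $\omega(G-S)>1$. The toughness $\tau(G)$ is the largest $t$ for which $G$ is $t$-tough, with the convention $\tau(K_n)=\infty$ for all $n\ge1$.
   Formalization: The parameter t in the definition of t-toughness is taken over the rationals instead of the reals, so the toughness $\tau(H)$ is the largest rational t for which H is t-tough. -}

module Defs where

open import Data.Nat using (ℕ; suc; _<_)
open import Data.Fin using (Fin)
open import Data.Fin.Subset using (Subset; _∈_; _∉_; ∣_∣)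
open import Data.Bool using (Bool; true; false)
open import Data.Integer using (+_)
open import Data.Rational using (ℚ; _/_; _*_; _≤_; ½) renaming (_<_ to _<ℚ_)
open import Data.Product using (Σ; ∃; _×_)
open import Relation.Binary.PropositionalEquality using (_≡_)
open import Relation.Nullary using (¬_)
open import Function.Bundles using (_⇔_)

record Graph (n : ℕ) : Set where
  field
    Adj    : Fin n → Fin n → Bool
    sym    : ∀ u v → Adj u v ≡ Adj v u
    irrefl : ∀ v → Adj v v ≡ false
open Graph public

SpanningSubgraph : ∀ {n} → Graph n → Graph n → Set
SpanningSubgraph H G = ∀ u v → Adj H u v ≡ true → Adj G u v ≡ true

IsComplete : ∀ {n} → Graph n → Set
IsComplete {n} G = ∀ (u v : Fin n) → ¬ (u ≡ v) → Adj G u v ≡ true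

data Reach {n} (G : Graph n) (S : Subset n) (u : Fin n) : Fin n → Set where
  here : u ∉ S → Reach G S u u
  step : ∀ {v w} → Reach G S u v → Adj G v w ≡ true → w ∉ S → Reach G S u w

-- G - S has exactly k connected components: there is a surjective labelling
-- of the vertices of G - S by Fin k whose fibres are exactly the
-- connected components.
Components : ∀ {n} → Graph n → Subset n → ℕ → Set
Components {n} G S k =
  Σ ((v : Fin n) → v ∉ S → Fin k) λ c →
    (∀ (i : Fin k) → ∃ λ v → Σ (v ∉ S) λ p → c v p ≡ i) ×
    (∀ u v (p : u ∉ S) (q : v ∉ S) → (c u p ≡ c v q) ⇔ Reach G S u v)

ℕtoℚ : ℕ → ℚ
ℕtoℚ m = + m / 1

Tough : ∀ {n} → Graph n → ℚ → Set
Tough {n} G t = ∀ (S : Subset n) (k : ℕ) → Components G S k → 1 < k →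
  t * ℕtoℚ k ≤ ℕtoℚ ∣ S ∣

ToughnessIs : ∀ {n} → Graph n → ℚ → Set
ToughnessIs G t = Tough G t × (∀ t' → t <ℚ t' → ¬ Tough G t')

module Submission where

-- Pass to an edge-minimal ½-tough spanning subgraph F of G; it suffices to find S with
-- ω(F - S) > 1 and ω(F - S) ≥ 2|S|. If some vertex v has two neighbours a ≠ b, either {v}
-- separates a from b, or F - va is still connected; in the latter case minimality yields a
-- set S, necessarily nonempty, with ω(F - va - S) > 2|S|, and since deleting an edge raises
-- the number of components by at most one, ω(F - S) ≥ 2|S| ≥ 2. If no vertex has two
-- neighbours, the connected graph F is K₂, which is excluded.

open import Defs
open import Data.Nat using (ℕ; zero; suc; _+_; _*_; _≤_; _<_; z≤n; s≤s)
import Data.Nat.Properties as ℕ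
open import Data.Fin using (Fin; zero; suc)
open import Data.Fin.Properties using (_≟_; any?; suc-injective; injective⇒≤)
open import Data.Fin.Subset using (Subset; _∈_; _∉_; ∣_∣; _∪_; ⁅_⁆; ⊥; _⊆_)
open import Data.Fin.Subset.Properties
  using ( ∣p∣≤n; ∣p∣≡n⇒p≡⊤; ∈⊤; ∉⊥; ⊥⊆; ∣⊥∣≡0; ∣⁅x⁆∣≡1; x∈⁅x⁆; x≢y⇒x∉⁅y⁆
        ; p⊂q⇒∣p∣<∣q∣; p⊆p∪q; x∈p∪q⁻; x∈p∪q⁺; _∈?_; nonempty?; anySubset?)
open import Data.Bool using (Bool; true; false)
import Data.Bool.Properties as Bool
open import Data.Product using (Σ; ∃; ∃₂; _×_; _,_; proj₁; proj₂)
open import Data.Sum using (_⊎_; inj₁; inj₂; [_,_])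
open import Relation.Binary.PropositionalEquality
  using (_≡_; refl; cong; subst; subst₂; trans) renaming (sym to ≡-sym)
open import Relation.Nullary using (¬_; Dec; yes; no; contradiction)
open import Relation.Nullary.Decidable using (_×-dec_; _⊎-dec_; ¬?; map′)
open import Data.List using (List; []; _∷_; cartesianProduct; allFin)
open import Data.List.Relation.Unary.Any using (here; there)
open import Data.List.Membership.Propositional using () renaming (_∈_ to _∈L_)
open import Data.List.Membership.Propositional.Properties using (∈-cartesianProduct⁺; ∈-allFin)
open import Data.Integer using (+_)
import Data.Integer as ℤ
import Data.Integer.Properties as ℤ
open import Data.Rational using (ℚ; mkℚ; ½; toℚᵘ)
  renaming (_≤_ to _≤ℚ_; _<_ to _<ℚ_; _*_ to _*ℚ_)
import Data.Rational.Properties as ℚ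
import Data.Rational.Unnormalised as ℚᵘ
import Data.Rational.Unnormalised.Properties as ℚᵘ
open import Data.Nat.Coprimality using (1-coprimeTo) renaming (sym to coprime-sym)
open import Function using (_∘_)
open import Function.Bundles using (_⇔_; mk⇔; Equivalence)

open Equivalence using (to; from)

x∉p∪⁅y⁆ : ∀ {n} {p : Subset n} {x y} → x ∉ p → ¬ x ≡ y → x ∉ p ∪ ⁅ y ⁆
x∉p∪⁅y⁆ {p = p} {y = y} x∉p x≢y x∈p∪y = [ x∉p , x≢y⇒x∉⁅y⁆ x≢y ] (x∈p∪q⁻ p ⁅ y ⁆ x∈p∪y)

n≤∣p∣⇒x∈p : ∀ {n} {p : Subset n} {x} → n ≤ ∣ p ∣ → x ∈ p
n≤∣p∣⇒x∈p {p = p} n≤∣p∣ = subst (_ ∈_) (≡-sym (∣p∣≡n⇒p≡⊤ (ℕ.≤-antisym (∣p∣≤n p) n≤∣p∣))) ∈⊤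

x∉p⇒∣p∣<∣p∪⁅x⁆∣ : ∀ {n} {p : Subset n} {x} → x ∉ p → ∣ p ∣ < ∣ p ∪ ⁅ x ⁆ ∣
x∉p⇒∣p∣<∣p∪⁅x⁆∣ {x = x} x∉p = p⊂q⇒∣p∣<∣q∣ (p⊆p∪q ⁅ x ⁆ , x , x∈p∪q⁺ (inj₂ (x∈⁅x⁆ x)) , x∉p)

x∈p⇒0<∣p∣ : ∀ {n} {p : Subset n} {x} → x ∈ p → 0 < ∣ p ∣
x∈p⇒0<∣p∣ {n} {p} {x} x∈p = subst (_< ∣ p ∣) (∣⊥∣≡0 n) (p⊂q⇒∣p∣<∣q∣ (⊥⊆ , x , x∈p , ∉⊥))

module _ {n} {G : Graph n} where

  Reach-source : ∀ {S u v} → Reach G S u v → u ∉ S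
  Reach-source (here u∉S)   = u∉S
  Reach-source (step r _ _) = Reach-source r

  Reach-target : ∀ {S u v} → Reach G S u v → v ∉ S
  Reach-target (here v∉S)     = v∉S
  Reach-target (step _ _ v∉S) = v∉S

  Reach-trans : ∀ {S u v w} → Reach G S u v → Reach G S v w → Reach G S u w
  Reach-trans r (here _)      = r
  Reach-trans r (step r′ e p) = step (Reach-trans r r′) e p

  Reach-prepend : ∀ {S u v w} → u ∉ S → Adj G u v ≡ true → Reach G S v w → Reach G S u w
  Reach-prepend u∉S e r = Reach-trans (step (here u∉S) e (Reach-source r)) r

  Reach-sym : ∀ {S u v} → Reach G S u v → Reach G S v u
  Reach-sym (here p)     = here p
  Reach-sym (step r e p) = Reach-prepend p (trans (Graph.sym G _ _) e) (Reach-sym r)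

  Reach-antimono : ∀ {S S′ u v} → S ⊆ S′ → Reach G S′ u v → Reach G S u v
  Reach-antimono S⊆S′ (here p)     = here (λ m → p (S⊆S′ m))
  Reach-antimono S⊆S′ (step r e p) = step (Reach-antimono S⊆S′ r) e (λ m → p (S⊆S′ m))

  Reach-uncons : ∀ {S u v} → Reach G S u v →
    v ≡ u ⊎ ∃ λ w → Adj G u w ≡ true × Reach G (S ∪ ⁅ u ⁆) w v
  Reach-uncons (here _) = inj₁ refl
  Reach-uncons {S} {u} (step {w = x} r e x∉S) with x ≟ u
  ... | yes x≡u = inj₁ x≡u
  ... | no x≢u with Reach-uncons r
  ...   | inj₁ refl          = inj₂ (x , e , here (x∉p∪⁅y⁆ x∉S x≢u))
  ...   | inj₂ (w , e′ , r′) = inj₂ (w , e′ , step r′ e (x∉p∪⁅y⁆ x∉S x≢u))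

  -- Each step of the search moves the current vertex into S, so the fuel f never runs out.
  reach?-within : ∀ f S u v → n ≤ f + ∣ S ∣ → Dec (Reach G S u v)
  reach?-within f S u v _ with u ∈? S
  ... | yes u∈S = no (λ r → Reach-source r u∈S)
  reach?-within zero S u v n≤∣S∣ | no u∉S = contradiction (n≤∣p∣⇒x∈p n≤∣S∣) u∉S
  reach?-within (suc f) S u v n≤f+∣S∣ | no u∉S with v ≟ u
  ... | yes refl = yes (here u∉S)
  ... | no v≢u   = map′ prepend uncons (any? step?)
    where
    n≤f+∣S∪u∣ : n ≤ f + ∣ S ∪ ⁅ u ⁆ ∣
    n≤f+∣S∪u∣ = ℕ.≤-trans n≤f+∣S∣
      (ℕ.≤-trans (ℕ.≤-reflexive (≡-sym (ℕ.+-suc f ∣ S ∣))) (ℕ.+-monoʳ-≤ f (x∉p⇒∣p∣<∣p∪⁅x⁆∣ u∉S)))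
    step? : ∀ w → Dec (Adj G u w ≡ true × Reach G (S ∪ ⁅ u ⁆) w v)
    step? w = (Adj G u w Bool.≟ true) ×-dec reach?-within f (S ∪ ⁅ u ⁆) w v n≤f+∣S∪u∣
    prepend : (∃ λ w → Adj G u w ≡ true × Reach G (S ∪ ⁅ u ⁆) w v) → Reach G S u v
    prepend (w , e , r) = Reach-prepend u∉S e (Reach-antimono (p⊆p∪q ⁅ u ⁆) r)
    uncons : Reach G S u v → ∃ λ w → Adj G u w ≡ true × Reach G (S ∪ ⁅ u ⁆) w v
    uncons r = [ (λ v≡u → contradiction v≡u v≢u) , (λ x → x) ] (Reach-uncons r)

  reach? : ∀ S u v → Dec (Reach G S u v)
  reach? S u v = reach?-within n S u v (ℕ.m≤m+n n ∣ S ∣)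

Reach-mono : ∀ {n} {H G : Graph n} → SpanningSubgraph H G →
  ∀ {S u v} → Reach H S u v → Reach G S u v
Reach-mono H⊆G (here p)     = here p
Reach-mono H⊆G (step r e p) = step (Reach-mono H⊆G r) (H⊆G _ _ e) p

-- Components G S k is Classes (_∉ S) (Reach G S) k.
Classes : ∀ {n} (P : Fin n → Set) (R : Fin n → Fin n → Set) → ℕ → Set
Classes {n} P R k = Σ ((v : Fin n) → P v → Fin k) λ c →
    (∀ (i : Fin k) → ∃ λ v → Σ (P v) λ p → c v p ≡ i) ×
    (∀ u v (p : P u) (q : P v) → (c u p ≡ c v q) ⇔ R u v)

module _ {n} {P : Fin n → Set} {R : Fin n → Fin n → Set} where

  Classes-separated⇒1< : ∀ {k a b} → Classes P R k → P a → P b → ¬ R a b → 1 < k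
  Classes-separated⇒1< {suc (suc k)} _ _ _ _ = s≤s (s≤s z≤n)
  Classes-separated⇒1< {suc zero} {a} {b} (c , _ , fb) pa pb ¬ab with c a pa | c b pb | to (fb a b pa pb)
  ... | zero | zero | ab = contradiction (ab refl) ¬ab
  Classes-separated⇒1< {zero} {a} (c , _ , _) pa _ _ with c a pa
  ... | ()

  Classes-≤1 : ∀ {k} v → P v → (∀ x → P x → R x v) → Classes P R k → k ≤ 1
  Classes-≤1 {zero}        _ _  _   _            = z≤n
  Classes-≤1 {suc zero}    _ _  _   _            = s≤s z≤n
  Classes-≤1 {suc (suc k)} v pv x~v (c , sj , fb) with sj zero | sj (suc zero)
  ... | x , px , cx≡0 | y , py , cy≡1 with
        trans (≡-sym cx≡0) (trans (from (fb x v px pv) (x~v x px))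
          (trans (≡-sym (from (fb y v py pv) (x~v y py))) cy≡1))
  ...   | ()

  Classes-coarser-≤ : ∀ {R′ : Fin n → Fin n → Set} {k k′} →
    (∀ {u v} → R u v → R′ u v) → Classes P R k → Classes P R′ k′ → k′ ≤ k
  Classes-coarser-≤ R⇒R′ (c , sj , fb) (c′ , sj′ , fb′) = injective⇒≤ {f = f} f-injective
    where
    f : _ → _
    f i = c (proj₁ (sj′ i)) (proj₁ (proj₂ (sj′ i)))
    f-injective : ∀ {i j} → f i ≡ f j → i ≡ j
    f-injective {i} {j} e with sj′ i | sj′ j
    ... | u , p , ei | v , q , ej =
      trans (≡-sym ei) (trans (from (fb′ u v p q) (R⇒R′ (to (fb u v p q) e))) ej)

  Classes-unique : ∀ {k k′} → Classes P R k → Classes P R k′ → k ≡ k′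
  Classes-unique C C′ =
    ℕ.≤-antisym (Classes-coarser-≤ (λ r → r) C′ C) (Classes-coarser-≤ (λ r → r) C C′)

  Classes-≤-suc : ∀ {R′ : Fin n → Fin n → Set} {k k′ b} → P b →
    (∀ {u v} → R′ u v → R u v ⊎ R b v ⊎ R u b) →
    Classes P R k → Classes P R′ k′ → k ≤ suc k′
  Classes-≤-suc {k = k} {k′} {b} pb R′⇒ (c , sj , fb) (c′ , sj′ , fb′) =
    injective⇒≤ {f = g} g-injective
    where
    f : Fin k → Fin k′
    f i = c′ (proj₁ (sj i)) (proj₁ (proj₂ (sj i)))
    g : Fin k → Fin (suc k′)
    g i with i ≟ c b pb
    ... | yes _ = zero
    ... | no _  = suc (f i)
    g-injective : ∀ {i j} → g i ≡ g j → i ≡ j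
    g-injective {i} {j} e with i ≟ c b pb | j ≟ c b pb
    ... | yes i≡b | yes j≡b = trans i≡b (≡-sym j≡b)
    g-injective () | yes _ | no _
    g-injective () | no _  | yes _
    ... | no i≢b  | no j≢b with sj i | sj j
    ...   | u , p , ei | v , q , ej with R′⇒ (to (fb′ u v p q) (suc-injective e))
    ...     | inj₁ u~v        = trans (≡-sym ei) (trans (from (fb u v p q) u~v) ej)
    ...     | inj₂ (inj₁ b~v) = contradiction (trans (≡-sym ej) (≡-sym (from (fb b v pb q) b~v))) j≢b
    ...     | inj₂ (inj₂ u~b) = contradiction (trans (≡-sym ei) (from (fb u b p pb) u~b)) i≢b

classes : ∀ {n} (P : Fin n → Set) (R : Fin n → Fin n → Set) →
  (∀ v → Dec (P v)) → (∀ u v → Dec (R u v)) →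
  (∀ v → P v → R v v) → (∀ {u v} → R u v → R v u) → (∀ {u v w} → R u v → R v w → R u w) →
  Σ ℕ (Classes P R)
classes {zero} P R P? R? refl′ sym′ trans′ = 0 , (λ ()) , (λ ()) , (λ ())
classes {suc n} P R P? R? refl′ sym′ trans′
  with classes (λ v → P (suc v)) (λ u v → R (suc u) (suc v))
               (λ v → P? (suc v)) (λ u v → R? (suc u) (suc v)) (λ v → refl′ (suc v)) sym′ trans′
... | k , c , sj , fb with P? zero
...   | no ¬p₀ = k , c⁺ , sj⁺ , fb⁺
  where
  c⁺ : ∀ v → P v → Fin k
  c⁺ zero    p = contradiction p ¬p₀
  c⁺ (suc v) p = c v p
  sj⁺ : ∀ i → ∃ λ v → Σ (P v) λ p → c⁺ v p ≡ i
  sj⁺ i with sj i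
  ... | v , p , e = suc v , p , e
  fb⁺ : ∀ u v (p : P u) (q : P v) → (c⁺ u p ≡ c⁺ v q) ⇔ R u v
  fb⁺ zero    _       p _ = contradiction p ¬p₀
  fb⁺ (suc u) zero    _ q = contradiction q ¬p₀
  fb⁺ (suc u) (suc v) p q = fb u v p q
...   | yes p₀ with any? (λ w → P? (suc w) ×-dec R? zero (suc w))
...     | yes (w , pw , 0~w) = k , c⁺ , sj⁺ , fb⁺
  where
  c⁺ : ∀ v → P v → Fin k
  c⁺ zero    p = c w pw
  c⁺ (suc v) p = c v p
  sj⁺ : ∀ i → ∃ λ v → Σ (P v) λ p → c⁺ v p ≡ i
  sj⁺ i with sj i
  ... | v , p , e = suc v , p , e
  fb⁺ : ∀ u v (p : P u) (q : P v) → (c⁺ u p ≡ c⁺ v q) ⇔ R u v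
  fb⁺ zero    zero    p q = mk⇔ (λ _ → refl′ zero p) (λ _ → refl)
  fb⁺ zero    (suc v) p q = mk⇔ (λ e → trans′ 0~w (to (fb w v pw q) e))
                                (λ r → from (fb w v pw q) (trans′ (sym′ 0~w) r))
  fb⁺ (suc u) zero    p q = mk⇔ (λ e → sym′ (trans′ 0~w (to (fb w u pw p) (≡-sym e))))
                                (λ r → ≡-sym (from (fb w u pw p) (trans′ (sym′ 0~w) (sym′ r))))
  fb⁺ (suc u) (suc v) p q = fb u v p q
...     | no ¬0~any = suc k , c⁺ , sj⁺ , fb⁺
  where
  c⁺ : ∀ v → P v → Fin (suc k)
  c⁺ zero    p = zero
  c⁺ (suc v) p = suc (c v p)
  sj⁺ : ∀ i → ∃ λ v → Σ (P v) λ p → c⁺ v p ≡ i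
  sj⁺ zero = zero , p₀ , refl
  sj⁺ (suc i) with sj i
  ... | v , p , e = suc v , p , cong suc e
  fb⁺ : ∀ u v (p : P u) (q : P v) → (c⁺ u p ≡ c⁺ v q) ⇔ R u v
  fb⁺ zero    zero    p q = mk⇔ (λ _ → refl′ zero p) (λ _ → refl)
  fb⁺ zero    (suc v) p q = mk⇔ (λ ()) (λ r → contradiction (v , q , r) ¬0~any)
  fb⁺ (suc u) zero    p q = mk⇔ (λ ()) (λ r → contradiction (u , p , sym′ r) ¬0~any)
  fb⁺ (suc u) (suc v) p q = mk⇔ (λ e → to (fb u v p q) (suc-injective e))
                                (λ r → cong suc (from (fb u v p q) r))

-- Nothing below depends on how ω is computed; unfolding it makes type checking much slower.
abstract
  components : ∀ {n} (G : Graph n) (S : Subset n) → Σ ℕ (Components G S)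
  components G S =
    classes (_∉ S) (Reach G S) (λ v → ¬? (v ∈? S)) (reach? S) (λ _ → here) Reach-sym Reach-trans

ω : ∀ {n} → Graph n → Subset n → ℕ
ω G S = proj₁ (components G S)

ω-components : ∀ {n} (G : Graph n) (S : Subset n) → Components G S (ω G S)
ω-components G S = proj₂ (components G S)

Components⇒≡ω : ∀ {n} {G : Graph n} {S k} → Components G S k → k ≡ ω G S
Components⇒≡ω {G = G} {S} C = Classes-unique C (ω-components G S)

ω-antimono : ∀ {n} {H G : Graph n} → SpanningSubgraph H G → ∀ S → ω G S ≤ ω H S
ω-antimono {H = H} {G} H⊆G S =
  Classes-coarser-≤ (Reach-mono H⊆G) (ω-components H S) (ω-components G S)

connected⇒ω≤1 : ∀ {n} {G : Graph n} {S} v → v ∉ S →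
  (∀ x → x ∉ S → Reach G S x v) → ω G S ≤ 1
connected⇒ω≤1 {G = G} {S} v v∉S x~v = Classes-≤1 v v∉S x~v (ω-components G S)

HalfTough : ∀ {n} → Graph n → Set
HalfTough {n} G = ∀ (S : Subset n) → 1 < ω G S → ω G S ≤ ∣ S ∣ * 2

HalfToughViolation : ∀ {n} → Graph n → Subset n → Set
HalfToughViolation G S = 1 < ω G S × ∣ S ∣ * 2 < ω G S

halfTough? : ∀ {n} (G : Graph n) → HalfTough G ⊎ ∃ (HalfToughViolation G)
halfTough? G with anySubset? (λ S → (1 ℕ.<? ω G S) ×-dec (∣ S ∣ * 2 ℕ.<? ω G S))
... | yes violation = inj₂ violation
... | no ¬violation = inj₁ (λ S 1<ω → ℕ.≮⇒≥ (λ 2s<ω → ¬violation (S , 1<ω , 2s<ω)))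

¬HalfTough : ∀ {n} {G : Graph n} {S} → HalfToughViolation G S → ¬ HalfTough G
¬HalfTough {S = S} (1<ω , 2s<ω) tough = ℕ.<⇒≱ 2s<ω (tough S 1<ω)

HalfTough-mono : ∀ {n} {H G : Graph n} → SpanningSubgraph H G → HalfTough H → HalfTough G
HalfTough-mono H⊆G tough S 1<ωG =
  ℕ.≤-trans (ω-antimono H⊆G S) (tough S (ℕ.<-≤-trans 1<ωG (ω-antimono H⊆G S)))

HalfTough⇒connected : ∀ {n} {G : Graph n} → HalfTough G → ∀ u v → Reach G ⊥ u v
HalfTough⇒connected {n} {G} tough u v with reach? ⊥ u v
... | yes u~v = u~v
... | no ¬u~v =
  contradiction (ℕ.<-≤-trans 1<ω (tough ⊥ 1<ω)) (subst (λ s → ¬ 1 < s * 2) (≡-sym (∣⊥∣≡0 n)) λ ())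
  where
  1<ω : 1 < ω G ⊥
  1<ω = Classes-separated⇒1< (ω-components G ⊥) ∉⊥ ∉⊥ ¬u~v

SamePair : ∀ {n} (a b u v : Fin n) → Set
SamePair a b u v = (u ≡ a × v ≡ b) ⊎ (u ≡ b × v ≡ a)

samePair? : ∀ {n} (a b u v : Fin n) → Dec (SamePair a b u v)
samePair? a b u v = ((u ≟ a) ×-dec (v ≟ b)) ⊎-dec ((u ≟ b) ×-dec (v ≟ a))

SamePair-swap : ∀ {n} {a b u v : Fin n} → SamePair a b u v → SamePair a b v u
SamePair-swap (inj₁ (u≡a , v≡b)) = inj₂ (v≡b , u≡a)
SamePair-swap (inj₂ (u≡b , v≡a)) = inj₁ (v≡a , u≡b)

falseIf : ∀ {P : Set} → Dec P → Bool → Bool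
falseIf (yes _) _ = false
falseIf (no _)  x = x

removeEdge : ∀ {n} → Graph n → Fin n → Fin n → Graph n
removeEdge {n} G a b = record { Adj = Adj⁻ ; sym = sym⁻ ; irrefl = irrefl⁻ }
  where
  Adj⁻ : Fin n → Fin n → Bool
  Adj⁻ u v = falseIf (samePair? a b u v) (Adj G u v)
  sym⁻ : ∀ u v → Adj⁻ u v ≡ Adj⁻ v u
  sym⁻ u v with samePair? a b u v | samePair? a b v u
  ... | yes _  | yes _  = refl
  ... | no _   | no _   = Graph.sym G u v
  ... | yes uv | no ¬vu = contradiction (SamePair-swap uv) ¬vu
  ... | no ¬uv | yes vu = contradiction (SamePair-swap vu) ¬uv
  irrefl⁻ : ∀ v → Adj⁻ v v ≡ false
  irrefl⁻ v with samePair? a b v v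
  ... | yes _ = refl
  ... | no _  = Graph.irrefl G v

module _ {n} (G : Graph n) (a b : Fin n) where

  removeEdge-spanning : SpanningSubgraph (removeEdge G a b) G
  removeEdge-spanning u v e with samePair? a b u v
  ... | no _ = e

  removeEdge-keeps : ∀ {u v} → Adj G u v ≡ true → ¬ SamePair a b u v →
    Adj (removeEdge G a b) u v ≡ true
  removeEdge-keeps {u} {v} e ¬ab with samePair? a b u v
  ... | yes ab = contradiction ab ¬ab
  ... | no _   = e

  removeEdge-removes : ¬ Adj (removeEdge G a b) a b ≡ true
  removeEdge-removes with samePair? a b a b
  ... | yes _  = λ ()
  ... | no ¬ab = contradiction (inj₁ (refl , refl)) ¬ab

removeEdge-mono : ∀ {n} {H G : Graph n} a b → SpanningSubgraph H G →
  SpanningSubgraph (removeEdge H a b) (removeEdge G a b)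
removeEdge-mono a b H⊆G u v e with samePair? a b u v
... | no _ = H⊆G u v e

module _ {n} {G : Graph n} {a b : Fin n} {S : Subset n} where
  private
    G⁻ = removeEdge G a b

  Reach-removeEdge : ∀ {x y} → Reach G S x y →
    Reach G⁻ S x y ⊎ (Reach G⁻ S x a × Reach G⁻ S b y) ⊎ (Reach G⁻ S x b × Reach G⁻ S a y)
  Reach-removeEdge (here p) = inj₁ (here p)
  Reach-removeEdge (step {v} {w} r e w∉S) with samePair? a b v w | Reach-removeEdge r
  ... | no ¬ab | inj₁ x~v                 = inj₁ (step x~v (removeEdge-keeps G a b e ¬ab) w∉S)
  ... | no ¬ab | inj₂ (inj₁ (x~a , b~v)) = inj₂ (inj₁ (x~a , step b~v (removeEdge-keeps G a b e ¬ab) w∉S))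
  ... | no ¬ab | inj₂ (inj₂ (x~b , a~v)) = inj₂ (inj₂ (x~b , step a~v (removeEdge-keeps G a b e ¬ab) w∉S))
  ... | yes (inj₁ (refl , refl)) | inj₁ x~a               = inj₂ (inj₁ (x~a , here w∉S))
  ... | yes (inj₁ (refl , refl)) | inj₂ (inj₁ (x~a , _)) = inj₂ (inj₁ (x~a , here w∉S))
  ... | yes (inj₁ (refl , refl)) | inj₂ (inj₂ (x~b , _)) = inj₁ x~b
  ... | yes (inj₂ (refl , refl)) | inj₁ x~b               = inj₂ (inj₂ (x~b , here w∉S))
  ... | yes (inj₂ (refl , refl)) | inj₂ (inj₁ (x~a , _)) = inj₁ x~a
  ... | yes (inj₂ (refl , refl)) | inj₂ (inj₂ (x~b , _)) = inj₂ (inj₂ (x~b , here w∉S))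

  ω-removeEdge : ω G⁻ S ≤ suc (ω G S)
  ω-removeEdge with b ∈? S
  ... | yes b∈S =
    ℕ.m≤n⇒m≤1+n (Classes-coarser-≤ Reach-survives (ω-components G S) (ω-components G⁻ S))
    where
    Reach-survives : ∀ {x y} → Reach G S x y → Reach G⁻ S x y
    Reach-survives r with Reach-removeEdge r
    ... | inj₁ x~y              = x~y
    ... | inj₂ (inj₁ (_ , b~y)) = contradiction b∈S (Reach-source b~y)
    ... | inj₂ (inj₂ (x~b , _)) = contradiction b∈S (Reach-target x~b)
  ... | no b∉S = Classes-≤-suc b∉S through-b (ω-components G⁻ S) (ω-components G S)
    where
    through-b : ∀ {x y} → Reach G S x y → Reach G⁻ S x y ⊎ Reach G⁻ S b y ⊎ Reach G⁻ S x b
    through-b r with Reach-removeEdge r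
    ... | inj₁ x~y              = inj₁ x~y
    ... | inj₂ (inj₁ (_ , b~y)) = inj₂ (inj₁ b~y)
    ... | inj₂ (inj₂ (x~b , _)) = inj₂ (inj₂ x~b)

EdgeMinimalOn : ∀ {n} → List (Fin n × Fin n) → Graph n → Set
EdgeMinimalOn L F = ∀ {a b} → (a , b) ∈L L → Adj F a b ≡ true → ¬ HalfTough (removeEdge F a b)

minimalHalfTough-on : ∀ {n} (L : List (Fin n × Fin n)) (G : Graph n) → HalfTough G →
  Σ (Graph n) λ F → SpanningSubgraph F G × HalfTough F × EdgeMinimalOn L F
minimalHalfTough-on [] G tough = G , (λ _ _ e → e) , tough , λ ()
minimalHalfTough-on ((a , b) ∷ L) G tough with halfTough? (removeEdge G a b)
... | inj₁ tough⁻ with minimalHalfTough-on L (removeEdge G a b) tough⁻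
...   | F , F⊆G⁻ , toughF , minimal = F , F⊆G , toughF , minimal⁺
  where
  F⊆G : SpanningSubgraph F G
  F⊆G u v e = removeEdge-spanning G a b u v (F⊆G⁻ u v e)
  minimal⁺ : EdgeMinimalOn ((a , b) ∷ L) F
  minimal⁺ (here refl) e _ = removeEdge-removes G a b (F⊆G⁻ a b e)
  minimal⁺ (there ab∈L) = minimal ab∈L
minimalHalfTough-on ((a , b) ∷ L) G tough | inj₂ (_ , violation) with minimalHalfTough-on L G tough
...   | F , F⊆G , toughF , minimal = F , F⊆G , toughF , minimal⁺
  where
  minimal⁺ : EdgeMinimalOn ((a , b) ∷ L) F
  minimal⁺ (here refl) _ toughF⁻ =
    ¬HalfTough violation (HalfTough-mono (removeEdge-mono {H = F} {G} a b F⊆G) toughF⁻)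
  minimal⁺ (there ab∈L) = minimal ab∈L

minimalHalfTough : ∀ {n} (G : Graph n) → HalfTough G →
  Σ (Graph n) λ F → SpanningSubgraph F G × HalfTough F ×
    (∀ a b → Adj F a b ≡ true → ¬ HalfTough (removeEdge F a b))
minimalHalfTough {n} G tough with minimalHalfTough-on (cartesianProduct (allFin n) (allFin n)) G tough
... | F , F⊆G , toughF , minimal =
  F , F⊆G , toughF , λ a b → minimal (∈-cartesianProduct⁺ (∈-allFin a) (∈-allFin b))

TightCut : ∀ {n} → Graph n → Subset n → Set
TightCut G S = 1 < ω G S × ∣ S ∣ * 2 ≤ ω G S

Adj⇒≢ : ∀ {n} (G : Graph n) {u v} → Adj G u v ≡ true → ¬ u ≡ v
Adj⇒≢ G {u} e refl with trans (≡-sym (Graph.irrefl G u)) e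
... | ()

cutVertex-tight : ∀ {n} {G : Graph n} {v a b} → Adj G v a ≡ true → Adj G v b ≡ true →
  ¬ Reach G ⁅ v ⁆ a b → TightCut G ⁅ v ⁆
cutVertex-tight {G = G} {v} {a} {b} va vb ¬a~b =
  1<ω , subst (λ s → s * 2 ≤ ω G ⁅ v ⁆) (≡-sym (∣⁅x⁆∣≡1 v)) 1<ω
  where
  1<ω : 1 < ω G ⁅ v ⁆
  1<ω = Classes-separated⇒1< (ω-components G ⁅ v ⁆)
          (x≢y⇒x∉⁅y⁆ (Adj⇒≢ G va ∘ ≡-sym)) (x≢y⇒x∉⁅y⁆ (Adj⇒≢ G vb ∘ ≡-sym)) ¬a~b

violation-removeEdge⇒tight : ∀ {n} {G : Graph n} {a b S} →
  HalfToughViolation (removeEdge G a b) S → 0 < ∣ S ∣ → TightCut G S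
violation-removeEdge⇒tight {G = G} {a} {b} {S} (_ , 2s<ω⁻) 0<∣S∣ =
  ℕ.<-≤-trans (ℕ.*-monoˡ-≤ 2 0<∣S∣) 2s≤ω , 2s≤ω
  where
  2s≤ω : ∣ S ∣ * 2 ≤ ω G S
  2s≤ω = ℕ.≤-pred (ℕ.≤-trans 2s<ω⁻ (ω-removeEdge {G = G} {a} {b} {S}))

removeEdge-connected : ∀ {n} {G : Graph n} {v a b} → (∀ x → Reach G ⊥ x v) →
  Adj G v b ≡ true → ¬ a ≡ b → Reach G ⁅ v ⁆ a b → ∀ x → Reach (removeEdge G v a) ⊥ x v
removeEdge-connected {G = G} {v} {a} {b} connected vb a≢b a~b x with Reach-removeEdge (connected x)
... | inj₁ x~v              = x~v
... | inj₂ (inj₁ (x~v , _)) = x~v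
... | inj₂ (inj₂ (x~a , _)) = Reach-trans x~a a~v
  where
  bv-kept : ¬ SamePair v a b v
  bv-kept (inj₁ (b≡v , _)) = Adj⇒≢ G vb (≡-sym b≡v)
  bv-kept (inj₂ (b≡a , _)) = a≢b (≡-sym b≡a)
  a~v : Reach (removeEdge G v a) ⊥ a v
  a~v with Reach-removeEdge a~b
  ... | inj₁ a~b⁻             = step (Reach-antimono ⊥⊆ a~b⁻)
                                  (removeEdge-keeps G v a (trans (Graph.sym G b v) vb) bv-kept) ∉⊥
  ... | inj₂ (inj₁ (a~v , _)) = contradiction (x∈⁅x⁆ v) (Reach-target a~v)
  ... | inj₂ (inj₂ (_ , v~b)) = contradiction (x∈⁅x⁆ v) (Reach-source v~b)

MaxDegree≤1 : ∀ {n} → Graph n → Set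
MaxDegree≤1 G = ∀ v a b → Adj G v a ≡ true → Adj G v b ≡ true → a ≡ b

Reach-maxDegree≤1 : ∀ {n} {G : Graph n} → MaxDegree≤1 G →
  ∀ {S x w} → Reach G S x w → w ≡ x ⊎ Adj G x w ≡ true
Reach-maxDegree≤1 Δ≤1 (here _) = inj₁ refl
Reach-maxDegree≤1 {G = G} Δ≤1 (step r e _) with Reach-maxDegree≤1 Δ≤1 r
... | inj₁ refl = inj₂ e
... | inj₂ xv   = inj₁ (≡-sym (Δ≤1 _ _ _ (trans (Graph.sym G _ _) xv) e))

connected-maxDegree≤1⇒complete : ∀ {n} {G : Graph n} → MaxDegree≤1 G →
  (∀ u v → Reach G ⊥ u v) → IsComplete G
connected-maxDegree≤1⇒complete Δ≤1 connected u v u≢v with Reach-maxDegree≤1 Δ≤1 (connected u v)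
... | inj₁ v≡u = contradiction (≡-sym v≡u) u≢v
... | inj₂ e   = e

maxDegree≤1-complete⇒≤2 : ∀ {n} {G : Graph n} → MaxDegree≤1 G → IsComplete G → n ≤ 2
maxDegree≤1-complete⇒≤2 {zero}                Δ≤1 complete = z≤n
maxDegree≤1-complete⇒≤2 {suc zero}            Δ≤1 complete = s≤s z≤n
maxDegree≤1-complete⇒≤2 {suc (suc zero)}      Δ≤1 complete = s≤s (s≤s z≤n)
maxDegree≤1-complete⇒≤2 {suc (suc (suc n))} Δ≤1 complete
  with Δ≤1 zero (suc zero) (suc (suc zero)) (complete _ _ (λ ())) (complete _ _ (λ ()))
... | ()

Fork : ∀ {n} → Graph n → Set
Fork {n} G = ∃ λ (v : Fin n) → ∃₂ λ a b → ¬ a ≡ b × Adj G v a ≡ true × Adj G v b ≡ true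

fork-or-maxDegree≤1 : ∀ {n} (G : Graph n) → Fork G ⊎ MaxDegree≤1 G
fork-or-maxDegree≤1 G
  with any? (λ v → any? (λ a → any? (λ b →
         ¬? (a ≟ b) ×-dec (Adj G v a Bool.≟ true) ×-dec (Adj G v b Bool.≟ true))))
... | yes fork = inj₁ fork
... | no ¬fork = inj₂ Δ≤1
  where
  Δ≤1 : MaxDegree≤1 G
  Δ≤1 v a b va vb with a ≟ b
  ... | yes a≡b = a≡b
  ... | no a≢b  = contradiction (v , a , b , a≢b , va , vb) ¬fork

minimalHalfTough⇒tightCut : ∀ {m} {G : Graph (suc (suc m))} → HalfTough G →
  (∀ a b → Adj G a b ≡ true → ¬ HalfTough (removeEdge G a b)) →
  ¬ (suc (suc m) ≡ 2 × IsComplete G) → ∃ (TightCut G)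
minimalHalfTough⇒tightCut {m} {G} tough minimal ¬K₂ with fork-or-maxDegree≤1 G
... | inj₂ Δ≤1 =
  contradiction (ℕ.≤-antisym (maxDegree≤1-complete⇒≤2 {G = G} Δ≤1 complete) (s≤s (s≤s z≤n)) , complete) ¬K₂
  where
  complete : IsComplete G
  complete = connected-maxDegree≤1⇒complete Δ≤1 (HalfTough⇒connected tough)
... | inj₁ (v , a , b , a≢b , va , vb) with reach? ⁅ v ⁆ a b
...   | no ¬a~b = ⁅ v ⁆ , cutVertex-tight va vb ¬a~b
...   | yes a~b with halfTough? (removeEdge G v a)
...     | inj₁ tough⁻ = contradiction tough⁻ (minimal v a va)
...     | inj₂ (S , violation@(1<ω⁻ , _)) with nonempty? S
...       | yes (_ , x∈S) = S , violation-removeEdge⇒tight violation (x∈p⇒0<∣p∣ x∈S)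
...       | no empty =
  contradiction (connected⇒ω≤1 v (λ v∈S → empty (v , v∈S)) x~v) (ℕ.<⇒≱ 1<ω⁻)
    where
    x~v : ∀ x → x ∉ S → Reach (removeEdge G v a) S x v
    x~v x _ = Reach-antimono (λ {y} y∈S → contradiction (y , y∈S) empty)
                (removeEdge-connected (λ x → HalfTough⇒connected tough x v) vb a≢b a~b x)

-- ℕtoℚ m = + m / 1 is equal to this normal form only propositionally; toℚᵘ computes on the latter.
ℕtoℚ-normal : ℕ → ℚ
ℕtoℚ-normal m = mkℚ (+ m) 0 (coprime-sym (1-coprimeTo m))

ℕtoℚ≡normal : ∀ m → ℕtoℚ m ≡ ℕtoℚ-normal m
ℕtoℚ≡normal m = ℚ.normalize-coprime (coprime-sym (1-coprimeTo m))

private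
  half : ℕ → ℚᵘ.ℚᵘ
  half k = toℚᵘ ½ ℚᵘ.* toℚᵘ (ℕtoℚ-normal k)

  ↥half≡ : ∀ k → ℚᵘ.↥ (half k) ℤ.* + 1 ≡ + k
  ↥half≡ k = trans (ℤ.*-identityʳ _) (ℤ.*-identityˡ (+ k))

  +s*2≡ : ∀ s → + s ℤ.* + 2 ≡ + (s * 2)
  +s*2≡ s = ≡-sym (ℤ.pos-* s 2)

  half≤⇔ : ∀ k s → half k ℚᵘ.≤ toℚᵘ (ℕtoℚ-normal s) ⇔ k ≤ s * 2
  half≤⇔ k s = mk⇔ (λ { (ℚᵘ.*≤* h) → ℤ.drop‿+≤+ (subst₂ ℤ._≤_ (↥half≡ k) (+s*2≡ s) h) })
                   (λ h → ℚᵘ.*≤* (subst₂ ℤ._≤_ (≡-sym (↥half≡ k)) (≡-sym (+s*2≡ s)) (ℤ.+≤+ h)))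

  ≤half : ∀ k s → s * 2 ≤ k → toℚᵘ (ℕtoℚ-normal s) ℚᵘ.≤ half k
  ≤half k s h = ℚᵘ.*≤* (subst₂ ℤ._≤_ (≡-sym (+s*2≡ s)) (≡-sym (↥half≡ k)) (ℤ.+≤+ h))

½*k≤s⇔k≤s*2 : ∀ k s → ½ *ℚ ℕtoℚ k ≤ℚ ℕtoℚ s ⇔ k ≤ s * 2
½*k≤s⇔k≤s*2 k s rewrite ℕtoℚ≡normal k | ℕtoℚ≡normal s = mk⇔
  (λ h → to (half≤⇔ k s) (ℚᵘ.≤-respˡ-≃ homo (ℚ.toℚᵘ-mono-≤ h)))
  (λ h → ℚ.toℚᵘ-cancel-≤ (ℚᵘ.≤-respˡ-≃ (ℚᵘ.≃-sym homo) (from (half≤⇔ k s) h)))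
  where homo = ℚ.toℚᵘ-homo-* ½ (ℕtoℚ-normal k)

½<t⇒¬t*k≤s : ∀ {t k s} → ½ <ℚ t → 0 < k → s * 2 ≤ k → ¬ (t *ℚ ℕtoℚ k ≤ℚ ℕtoℚ s)
½<t⇒¬t*k≤s {t} {suc k} {s} ½<t _ 2s≤k t*k≤s =
  ℚ.<-irrefl refl (ℚ.≤-<-trans s≤½*k (ℚ.<-≤-trans ½*k<t*k t*k≤s))
  where
  s≤½*k : ℕtoℚ s ≤ℚ ½ *ℚ ℕtoℚ (suc k)
  s≤½*k rewrite ℕtoℚ≡normal (suc k) | ℕtoℚ≡normal s =
    ℚ.toℚᵘ-cancel-≤ (ℚᵘ.≤-respʳ-≃ (ℚᵘ.≃-sym (ℚ.toℚᵘ-homo-* ½ (ℕtoℚ-normal (suc k))))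
                                   (≤half (suc k) s 2s≤k))
  ½*k<t*k : ½ *ℚ ℕtoℚ (suc k) <ℚ t *ℚ ℕtoℚ (suc k)
  ½*k<t*k rewrite ℕtoℚ≡normal (suc k) = ℚ.*-monoˡ-<-pos (ℕtoℚ-normal (suc k)) ½<t

Tough½⇒HalfTough : ∀ {n} {G : Graph n} → Tough G ½ → HalfTough G
Tough½⇒HalfTough {G = G} tough S 1<ω =
  to (½*k≤s⇔k≤s*2 (ω G S) ∣ S ∣) (tough S (ω G S) (ω-components G S) 1<ω)

HalfTough⇒Tough½ : ∀ {n} {G : Graph n} → HalfTough G → Tough G ½
HalfTough⇒Tough½ tough S k C 1<k with Components⇒≡ω C
... | refl = from (½*k≤s⇔k≤s*2 k ∣ S ∣) (tough S 1<k)

tightCut⇒¬Tough : ∀ {n} {G : Graph n} {S t} → TightCut G S → ½ <ℚ t → ¬ Tough G t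
tightCut⇒¬Tough {G = G} {S} (1<ω , 2s≤ω) ½<t tough =
  ½<t⇒¬t*k≤s {s = ∣ S ∣} ½<t (ℕ.<-trans (s≤s z≤n) 1<ω) 2s≤ω (tough S (ω G S) (ω-components G S) 1<ω)

proposition2p1 : ∀ {n : ℕ} (G : Graph n) → 1 ≤ n →
    ¬ (n ≡ 1) → ¬ (n ≡ 2 × IsComplete G) →
    Tough G ½ →
    Σ (Graph n) λ H → SpanningSubgraph H G × ToughnessIs H ½
proposition2p1 {zero}        G ()
proposition2p1 {suc zero}    G _ n≢1 = contradiction refl n≢1
proposition2p1 {suc (suc m)} G _ _ ¬K₂ tough½ with minimalHalfTough G (Tough½⇒HalfTough tough½)
... | F , F⊆G , toughF , minimal with minimalHalfTough⇒tightCut toughF minimal ¬K₂F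
  where
  ¬K₂F : ¬ (suc (suc m) ≡ 2 × IsComplete F)
  ¬K₂F (n≡2 , completeF) = ¬K₂ (n≡2 , λ u v u≢v → F⊆G u v (completeF u v u≢v))
...   | S , cut = F , F⊆G , HalfTough⇒Tough½ toughF , λ t ½<t → tightCut⇒¬Tough cut ½<t
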